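{- In a geodetic Hamiltonian graph, every vertex has at least two antipodes.
   Context: A geodesic is a shortest path; a graph is geodetic if between any two vertices there is exactly one geodesic. A graph is Hamiltonian if it has a cycle through all its vertices. An antipode of a vertex $v$ of a connected graph is a vertex at maximum distance from $v$. -}

module Defs where

open import Data.Nat using (ℕ; zero; suc; _≤_)
open import Data.Fin using (Fin; toℕ)
open import Data.Product using (Σ; ∃; _×_; _,_)
open import Relation.Nullary using (¬_; Dec)
open import Relation.Binary.PropositionalEquality using (_≡_; _≢_)
open import Function.Definitions using (Injective)

record Graph (n : ℕ) : Set₁ where
  field
    Adj     : Fin n → Fin n → Set
    adj?    : ∀ u v → Dec (Adj u v)
    sym     : ∀ {u v} → Adj u v → Adj v u
    irrefl  : ∀ {u} → ¬ Adj u u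

module _ {n : ℕ} (G : Graph n) where
  open Graph G

  data Walk : Fin n → Fin n → ℕ → Set where
    [] : ∀ {u} → Walk u u zero
    _∷_ : ∀ {u w v k} → Adj u w → Walk w v k → Walk u v (suc k)

  Dist : Fin n → Fin n → ℕ → Set
  Dist u v k = Walk u v k × (∀ m → Walk u v m → k ≤ m)

  Connected : Set
  Connected = ∀ u v → ∃ λ k → Walk u v k

  Geodetic : Set
  Geodetic = Connected ×
    (∀ u v k → Dist u v k → (p q : Walk u v k) → p ≡ q)

  -- A Hamiltonian cycle: n ≥ 3 and an injective (hence bijective) listing
  -- σ 0, …, σ (n-1) of the vertices with consecutive ones adjacent and
  -- σ (n-1) adjacent to σ 0.
  Hamiltonian : Set
  Hamiltonian = 3 ≤ n × Σ (Fin n → Fin n) λ σ →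
    Injective _≡_ _≡_ σ ×
    (∀ i j → toℕ j ≡ suc (toℕ i) → Adj (σ i) (σ j)) ×
    (∀ i j → suc (toℕ i) ≡ n → toℕ j ≡ 0 → Adj (σ i) (σ j))

  IsAntipode : Fin n → Fin n → Set
  IsAntipode v w = ∃ λ k → Dist v w k × (∀ x m → Dist v x m → m ≤ k)

{-# OPTIONS --safe #-}
module Submission where

-- Let w be a vertex farthest from v and a, b its two neighbours on the Hamiltonian
-- cycle. Each of a, b lies at distance d(v,w) or d(v,w) - 1 from v. If both were one
-- step closer, appending the edge to w to geodesics v⇝a and v⇝b would give two
-- geodesics v⇝w with different penultimate vertices. So w and one of a, b are two
-- distinct antipodes.

open import Defs
open import Data.Nat using (ℕ; zero; suc; _≤_; _<_; s≤s; _<?_)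
open import Data.Nat.Properties
  using (≤-antisym; ≮⇒≥; <-irrefl; m<n⇒m<1+n; n<1+n; m≤n⇒m<n∨m≡n; 1+n≰n; anyUpTo?)
open import Data.Nat.Induction using (<-wellFounded)
open import Induction.WellFounded using (Acc; acc)
open import Data.Fin using (Fin; zero; suc; toℕ; fromℕ; fromℕ<; punchOut; inject₁)
open import Data.Fin.Properties
  using (any?; _≟_; injective⇒≤; punchOut-injective; toℕ-fromℕ<; toℕ<n; toℕ-inject₁; toℕ-fromℕ)
open import Data.List using (allFin)
open import Data.List.Extrema.Nat using (argmax; f[xs]≤f[argmax])
open import Data.List.Membership.Propositional.Properties using (∈-allFin)
import Data.List.Relation.Unary.All as All
open import Data.Product using (∃; ∃₂; _×_; _,_; proj₁; proj₂)
open import Data.Sum using (_⊎_; inj₁; inj₂)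
open import Data.Empty using (⊥-elim)
open import Relation.Nullary using (¬_; Dec; yes; no)
open import Relation.Nullary.Decidable using (_×-dec_)
open import Relation.Unary using (Decidable)
open import Relation.Binary.PropositionalEquality using (_≡_; _≢_; refl; sym; cong; subst; ≢-sym; module ≡-Reasoning)
open import Function.Base using (_∘_)
open import Function.Definitions using (Injective)

Least : (ℕ → Set) → Set
Least P = ∃ λ m → P m × (∀ j → P j → m ≤ j)

least : ∀ {P : ℕ → Set} → Decidable P → ∀ {k} → P k → Least P
least {P} P? {k} = go k (<-wellFounded k)
  where
  go : ∀ k → Acc _<_ k → P k → Least P
  go k (acc smaller) Pk with anyUpTo? P? k
  ... | yes (j , j<k , Pj) = go j (smaller j<k) Pj
  ... | no none = k , Pk , λ j Pj → ≮⇒≥ λ j<k → none (j , j<k , Pj)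

maximiser : ∀ {n} (f : Fin n → ℕ) → Fin n → ∃ λ w → ∀ x → f x ≤ f w
maximiser {n} f x₀ =
  argmax f x₀ (allFin n) , λ x → All.lookup (f[xs]≤f[argmax] x₀ (allFin n)) (∈-allFin x)

injective⇒surjective : ∀ {n} {f : Fin n → Fin n} → Injective _≡_ _≡_ f → ∀ y → ∃ λ x → f x ≡ y
injective⇒surjective {suc n} {f} f-inj y with any? (λ x → f x ≟ y)
... | yes hit = hit
... | no miss = ⊥-elim (1+n≰n (injective⇒≤ f-avoiding-y-injective))
  where
  f≢y : ∀ x → y ≢ f x
  f≢y x eq = miss (x , sym eq)

  f-avoiding-y : Fin (suc n) → Fin n
  f-avoiding-y x = punchOut (f≢y x)

  f-avoiding-y-injective : Injective _≡_ _≡_ f-avoiding-y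
  f-avoiding-y-injective {x} {x′} eq = f-inj (punchOut-injective (f≢y x) (f≢y x′) eq)

CycleStep : ℕ → ℕ → ℕ → Set
CycleStep n a b = b ≡ suc a ⊎ (suc a ≡ n × b ≡ 0)

cycleSuccessor : ∀ {n} (i : Fin n) → ∃ λ (j : Fin n) → CycleStep n (toℕ i) (toℕ j)
cycleSuccessor {n@(suc _)} i with suc (toℕ i) <? n
... | yes i+1<n = fromℕ< i+1<n , inj₁ (toℕ-fromℕ< i+1<n)
... | no i+1≮n = zero , inj₂ (≤-antisym (toℕ<n i) (≮⇒≥ i+1≮n) , refl)

cyclePredecessor : ∀ {n} (j : Fin n) → ∃ λ (i : Fin n) → CycleStep n (toℕ i) (toℕ j)
cyclePredecessor {suc m} zero = fromℕ m , inj₂ (cong suc (toℕ-fromℕ m) , refl)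
cyclePredecessor {suc m} (suc i) = inject₁ i , inj₁ (cong suc (sym (toℕ-inject₁ i)))

cycleStep-asym : ∀ {n a b} → 3 ≤ n → CycleStep n a b → ¬ CycleStep n b a
cycleStep-asym _ (inj₁ refl) (inj₁ a≡a+2) = <-irrefl a≡a+2 (m<n⇒m<1+n (n<1+n _))
cycleStep-asym (s≤s (s≤s ())) (inj₁ refl) (inj₂ (refl , refl))
cycleStep-asym (s≤s (s≤s ())) (inj₂ (refl , refl)) (inj₁ refl)

module _ {n : ℕ} {G : Graph n} where
  open Graph G using (Adj; adj?; irrefl) renaming (sym to adj-sym)

  Adj⇒≢ : ∀ {x y} → Adj x y → x ≢ y
  Adj⇒≢ xy refl = irrefl xy

  Hamiltonian⇒twoNeighbours : Hamiltonian G → ∀ w → ∃₂ λ a b → a ≢ b × Adj a w × Adj b w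
  Hamiltonian⇒twoNeighbours (3≤n , σ , σ-inj , path , closing) w
    with injective⇒surjective σ-inj w
  ... | i , refl
    with cyclePredecessor i | cycleSuccessor i
  ... | h , h→i | j , i→j =
    σ h , σ j , h≢j ∘ σ-inj , cycleEdge h→i , adj-sym (cycleEdge i→j)
    where
    cycleEdge : ∀ {x y} → CycleStep n (toℕ x) (toℕ y) → Adj (σ x) (σ y)
    cycleEdge (inj₁ y≡x+1) = path _ _ y≡x+1
    cycleEdge (inj₂ (x+1≡n , y≡0)) = closing _ _ x+1≡n y≡0

    h≢j : h ≢ j
    h≢j refl = cycleStep-asym 3≤n h→i i→j

  walk? : ∀ u v k → Dec (Walk G u v k)
  walk? u v zero with u ≟ v
  ... | yes refl = yes []
  ... | no u≢v = no λ { [] → u≢v refl }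
  walk? u v (suc k) with any? (λ x → adj? u x ×-dec walk? x v k)
  ... | yes (x , ux , p) = yes (ux ∷ p)
  ... | no none = no λ { (ux ∷ p) → none (_ , ux , p) }

  _∷ʳ_ : ∀ {u x w k} → Walk G u x k → Adj x w → Walk G u w (suc k)
  [] ∷ʳ xw = xw ∷ []
  (ux ∷ p) ∷ʳ xw = ux ∷ (p ∷ʳ xw)

  penultimate : ∀ {u w k} → Walk G u w (suc k) → Fin n
  penultimate {u} (_ ∷ []) = u
  penultimate (_ ∷ p@(_ ∷ _)) = penultimate p

  penultimate-∷ʳ : ∀ {u x w k} (p : Walk G u x k) (xw : Adj x w) → penultimate (p ∷ʳ xw) ≡ x
  penultimate-∷ʳ [] xw = refl
  penultimate-∷ʳ (_ ∷ []) xw = refl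
  penultimate-∷ʳ (_ ∷ p@(_ ∷ _)) xw = penultimate-∷ʳ p xw

  Dist-unique : ∀ {u x k m} → Dist G u x k → Dist G u x m → k ≡ m
  Dist-unique (p , p-min) (q , q-min) = ≤-antisym (p-min _ q) (q-min _ p)

  distance : Connected G → ∀ u x → ∃ (Dist G u x)
  distance connected u x = least (walk? u x) (proj₂ (connected u x))

  Dist-≤-suc : ∀ {u x y k m} → Dist G u x k → Dist G u y m → Adj x y → m ≤ suc k
  Dist-≤-suc (p , _) (_ , q-min) xy = q-min _ (p ∷ʳ xy)

  UniqueGeodesics : Set
  UniqueGeodesics = ∀ u v k → Dist G u v k → (p q : Walk G u v k) → p ≡ q

  uniquePredecessor : UniqueGeodesics → ∀ {v w a b k} → Dist G v w (suc k) →
    Dist G v a k → Dist G v b k → Adj a w → Adj b w → a ≡ b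
  uniquePredecessor unique {v} {w} {a} {b} vw (p , _) (q , _) aw bw = begin
    a                    ≡⟨ sym (penultimate-∷ʳ p aw) ⟩
    penultimate (p ∷ʳ aw) ≡⟨ cong penultimate (unique v w _ vw (p ∷ʳ aw) (q ∷ʳ bw)) ⟩
    penultimate (q ∷ʳ bw) ≡⟨ penultimate-∷ʳ q bw ⟩
    b                    ∎
    where open ≡-Reasoning

  eccentricity : Connected G → ∀ v → ∃₂ λ k w → Dist G v w k × (∀ x m → Dist G v x m → m ≤ k)
  eccentricity connected v = d w , w , proj₂ (dist w) , bound
    where
    dist : ∀ x → ∃ (Dist G v x)
    dist = distance connected v

    d : Fin n → ℕ
    d x = proj₁ (dist x)

    w : Fin n
    w = proj₁ (maximiser d v)

    bound : ∀ x m → Dist G v x m → m ≤ d w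
    bound x m vx = subst (_≤ d w) (Dist-unique (proj₂ (dist x)) vx) (proj₂ (maximiser d v) x)

  neighbourOfFarthest : ∀ {v w x k m} → (∀ y j → Dist G v y j → j ≤ k) → Dist G v w k →
    Adj x w → Dist G v x m → m ≡ k ⊎ suc m ≡ k
  neighbourOfFarthest bound vw xw vx with m≤n⇒m<n∨m≡n (bound _ _ vx)
  ... | inj₁ m<k = inj₂ (≤-antisym m<k (Dist-≤-suc vx vw xw))
  ... | inj₂ m≡k = inj₁ m≡k

corollary2 : (n : ℕ) (G : Graph n) → Geodetic G → Hamiltonian G →
    (v : Fin n) → ∃ λ w₁ → ∃ λ w₂ →
      w₁ ≢ w₂ × IsAntipode G v w₁ × IsAntipode G v w₂
corollary2 n G (connected , unique) ham v
  with eccentricity connected v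
... | k , w , vw , bound
  with Hamiltonian⇒twoNeighbours {G = G} ham w
... | a , b , a≢b , aw , bw
  with distance connected v a | distance connected v b
... | _ , va | _ , vb
  with neighbourOfFarthest bound vw aw va | neighbourOfFarthest bound vw bw vb
... | inj₁ refl | _ = w , a , ≢-sym (Adj⇒≢ {G = G} aw) , (k , vw , bound) , (k , va , bound)
... | _ | inj₁ refl = w , b , ≢-sym (Adj⇒≢ {G = G} bw) , (k , vw , bound) , (k , vb , bound)
... | inj₂ refl | inj₂ refl = ⊥-elim (a≢b (uniquePredecessor unique vw va vb aw bw))
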